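{- Let $G$ be a graph with no induced $P_7$, $C_4$, $C_6$ or $C_7$, and let $H=(B_1,\dots,B_5)$ be a nice blowup of $C_5$ in $G$. Then for every $i$ there is no induced path $a-b-c-d$ with $a\in A'_3(i-2)$, $b,c\in A'_3(i-1)$ and $d\in A'_3(i)$.
   Context: Indices are modulo $5$. A tuple $(B_1,\dots,B_5)$ of pairwise disjoint nonempty vertex sets is a nice blowup of $C_5$ in $G$ if: each $B_i$ is a clique; every $v\in B_i$ has a neighbor in $B_{i-1}$ and in $B_{i+1}$; there are no edges between $B_i$ and $B_{i+2}$; and for every $i$, $a\in B_i$, distinct $b,c\in B_{i+1}$, $d\in B_{i+2}$, $G[\{a,b,c,d\}]$ is not an induced $P_4$. For $v\notin V(H)=\bigcup B_j$, $\mathrm{supp}(v)=\{j:N(v)\cap B_j\ne\emptyset\}$; $A_3(i)$ is the set of $v\notin V(H)$ with $\mathrm{supp}(v)=\{i-1,i,i+1\}$, and $A'_3(i)=A_3(i)\cup B_i$. -}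

module Defs where

open import Data.Nat using (ℕ; zero; suc)
open import Data.Fin using (Fin; zero; suc; toℕ)
open import Data.Fin.Subset using (Subset; _∈_; _∉_)
open import Data.Product using (Σ; ∃; ∃-syntax; _×_; _,_)
open import Data.Sum using (_⊎_)
open import Data.Empty using (⊥)
open import Relation.Nullary using (¬_)
open import Relation.Binary using (Decidable)
open import Relation.Binary.PropositionalEquality using (_≡_; _≢_)
open import Function.Definitions using (Injective)
open import Function.Bundles using (_⇔_)

record Graph : Set₁ where
  field
    n      : ℕ
    _~_    : Fin n → Fin n → Set
    ~-dec  : Decidable _~_
    ~-sym  : ∀ {u v} → u ~ v → v ~ u
    ~-irr  : ∀ {v} → ¬ (v ~ v)

PathAdj : (k : ℕ) → Fin k → Fin k → Set
PathAdj k i j = (toℕ j ≡ suc (toℕ i)) ⊎ (toℕ i ≡ suc (toℕ j))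

CycleAdj : (k : ℕ) → Fin k → Fin k → Set
CycleAdj k i j = PathAdj k i j
               ⊎ ((toℕ i ≡ 0 × suc (toℕ j) ≡ k) ⊎ (toℕ j ≡ 0 × suc (toℕ i) ≡ k))

module _ (G : Graph) where
  open Graph G

  HasInduced : (k : ℕ) → (Fin k → Fin k → Set) → Set
  HasInduced k R = Σ (Fin k → Fin n) λ f →
    Injective _≡_ _≡_ f × (∀ i j → (f i ~ f j) ⇔ R i j)

  -- a - b - c - d is an induced path (distinctness follows from irreflexivity/symmetry).
  InducedP4 : Fin n → Fin n → Fin n → Fin n → Set
  InducedP4 a b c d = a ~ b × b ~ c × c ~ d × ¬ (a ~ c) × ¬ (a ~ d) × ¬ (b ~ d)

  OneOf4 : Fin n → Fin n → Fin n → Fin n → Fin n → Set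
  OneOf4 a b c d w = w ≡ a ⊎ w ≡ b ⊎ w ≡ c ⊎ w ≡ d

  InducedP4On : Fin n → Fin n → Fin n → Fin n → Set
  InducedP4On a b c d = ∃[ w ] ∃[ x ] ∃[ y ] ∃[ z ]
    (OneOf4 a b c d w × OneOf4 a b c d x × OneOf4 a b c d y × OneOf4 a b c d z
     × InducedP4 w x y z)

next : Fin 5 → Fin 5
next zero = suc zero
next (suc zero) = suc (suc zero)
next (suc (suc zero)) = suc (suc (suc zero))
next (suc (suc (suc zero))) = suc (suc (suc (suc zero)))
next (suc (suc (suc (suc zero)))) = zero

prev : Fin 5 → Fin 5
prev zero = suc (suc (suc (suc zero)))
prev (suc zero) = zero
prev (suc (suc zero)) = suc zero
prev (suc (suc (suc zero))) = suc (suc zero)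
prev (suc (suc (suc (suc zero)))) = suc (suc (suc zero))

module _ (G : Graph) where
  open Graph G

  Blowup : Set
  Blowup = Fin 5 → Subset n

  record IsNiceBlowup (B : Blowup) : Set where
    field
      disjoint  : ∀ i j v → i ≢ j → v ∈ B i → v ∉ B j
      nonempty  : ∀ i → ∃[ v ] v ∈ B i
      clique    : ∀ i u v → u ∈ B i → v ∈ B i → u ≢ v → u ~ v
      nbr-prev  : ∀ i v → v ∈ B i → ∃[ u ] (u ∈ B (prev i) × v ~ u)
      nbr-next  : ∀ i v → v ∈ B i → ∃[ u ] (u ∈ B (next i) × v ~ u)
      anticomp  : ∀ i u v → u ∈ B i → v ∈ B (next (next i)) → ¬ (u ~ v)
      noP4      : ∀ i a b c d → a ∈ B i → b ∈ B (next i) → c ∈ B (next i) → b ≢ c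
                  → d ∈ B (next (next i)) → ¬ InducedP4On G a b c d

  module _ (B : Blowup) where
    InH : Fin n → Set
    InH v = ∃[ j ] v ∈ B j

    InSupp : Fin n → Fin 5 → Set
    InSupp v j = ∃[ u ] (u ∈ B j × v ~ u)

    A3 : Fin 5 → Fin n → Set
    A3 i v = ¬ InH v × (∀ j → InSupp v j ⇔ (j ≡ prev i ⊎ j ≡ i ⊎ j ≡ next i))

    A3' : Fin 5 → Fin n → Set
    A3' i v = A3 i v ⊎ v ∈ B i

{-# OPTIONS --safe #-}

-- Let a ~ x with x ∈ B(i+2), let x′ ∈ B(i+1) be a neighbour of x and y ∈ B(i+1) one of d.
-- By the support conditions a, b, c have no neighbour in B(i+1) and b, c, d none in B(i+2),
-- so x-a-b-c-d is an induced path whose ends both see the clique B(i+1).  If a single vertex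
-- of B(i+1) (y or x′) is adjacent to both x and d it closes a C₆; otherwise x-a-b-c-d-y-x′
-- is an induced C₇.

module Submission where

open import Defs
open import Data.Fin using (Fin; zero; suc; toℕ; _≟_)
open import Data.Fin.Properties using (all?; any?)
open import Data.Fin.Subset using (_∈_)
open import Data.Nat using (suc)
open import Data.Nat.Properties using (suc-injective)
import Data.Nat.Properties as ℕ
open import Data.Vec using (Vec; []; _∷_; lookup)
open import Data.Vec.Relation.Unary.All using (All; []; _∷_)
open import Data.Vec.Relation.Unary.All.Properties using (lookup⁺)
open import Data.Product using (∃-syntax; _×_; _,_)
open import Data.Sum using (_⊎_; inj₁; inj₂; [_,_]′; swap)
import Data.Sum as Sum
open import Data.Empty using (⊥-elim)
open import Function.Base using (_∘_; const)
open import Relation.Nullary using (¬_; yes; no; ¬?)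
open import Relation.Nullary.Decidable using (Dec; _⊎-dec_; _×-dec_; from-yes)
open import Relation.Binary using (Decidable)
open import Relation.Binary.PropositionalEquality using (_≡_; _≢_; refl; sym; trans; cong; subst)
open import Function.Definitions using (Injective)
open import Function.Bundles using (_⇔_; mk⇔; Equivalence)
open import Function.Construct.Composition using (_⇔-∘_)
open import Function.Construct.Symmetry using (⇔-sym)

open Equivalence using (to; from)

⇔-yes : ∀ {A B : Set} → A → B → A ⇔ B
⇔-yes a b = mk⇔ (const b) (const a)

⇔-no : ∀ {A B : Set} → ¬ A → ¬ B → A ⇔ B
⇔-no ¬a ¬b = mk⇔ (⊥-elim ∘ ¬a) (⊥-elim ∘ ¬b)

cycleAdj? : ∀ k → Decidable (CycleAdj k)
cycleAdj? k i j =
  ((toℕ j ℕ.≟ suc (toℕ i)) ⊎-dec (toℕ i ℕ.≟ suc (toℕ j)))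
  ⊎-dec (((toℕ i ℕ.≟ 0) ×-dec (suc (toℕ j) ℕ.≟ k))
         ⊎-dec ((toℕ j ℕ.≟ 0) ×-dec (suc (toℕ i) ℕ.≟ k)))

PathAdj-sym : ∀ {k} {i j : Fin k} → PathAdj k i j ⇔ PathAdj k j i
PathAdj-sym = mk⇔ swap swap

CycleAdj-sym : ∀ {k} {i j : Fin k} → CycleAdj k i j ⇔ CycleAdj k j i
CycleAdj-sym = mk⇔ (Sum.map swap swap) (Sum.map swap swap)

PathAdj-suc : ∀ {k} {i j : Fin k} → PathAdj (suc k) (suc i) (suc j) ⇔ PathAdj k i j
PathAdj-suc = mk⇔ (Sum.map suc-injective suc-injective) (Sum.map (cong suc) (cong suc))

PathAdj⇔CycleAdj-suc : ∀ {k} {i j : Fin (suc k)} →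
  PathAdj (suc k) i j ⇔ CycleAdj (suc (suc k)) (suc i) (suc j)
PathAdj⇔CycleAdj-suc = mk⇔ (inj₁ ∘ from PathAdj-suc) λ
  { (inj₁ p)            → to PathAdj-suc p
  ; (inj₂ (inj₁ (() , _)))
  ; (inj₂ (inj₂ (() , _)))
  }

IsEnd : ∀ {k} → Fin (suc k) → Set
IsEnd {k} j = toℕ j ≡ 0 ⊎ toℕ j ≡ k

IsEnd⇔CycleAdj-zero : ∀ {k} {j : Fin (suc k)} → IsEnd j ⇔ CycleAdj (suc (suc k)) zero (suc j)
IsEnd⇔CycleAdj-zero = mk⇔
  [ (λ j≡0 → inj₁ (inj₁ (cong suc j≡0))) , (λ j≡k → inj₂ (inj₁ (refl , cong suc (cong suc j≡k)))) ]′
  λ { (inj₁ (inj₁ e))       → inj₁ (suc-injective e)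
    ; (inj₁ (inj₂ ()))
    ; (inj₂ (inj₁ (_ , e)))  → inj₂ (suc-injective (suc-injective e))
    ; (inj₂ (inj₂ (() , _)))
    }

-- An adjacency pattern that separates vertices by neighbourhoods forces every realisation of
-- it to be injective; for cycles of length ≥ 5 this holds, and for C₆, C₇ it is decided by
-- evaluation.
Separates : ∀ {k} → (Fin k → Fin k → Set) → Set
Separates {k} R = ∀ (i j : Fin k) → i ≡ j ⊎ ∃[ l ] (R i l × ¬ R j l)

separates? : ∀ {k} {R : Fin k → Fin k → Set} → Decidable R → Dec (Separates R)
separates? R? = all? λ i → all? λ j → (i ≟ j) ⊎-dec any? λ l → R? i l ×-dec ¬? (R? j l)

C₆-separates : Separates (CycleAdj 6)
C₆-separates = from-yes (separates? (cycleAdj? 6))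

C₇-separates : Separates (CycleAdj 7)
C₇-separates = from-yes (separates? (cycleAdj? 7))

module _ (G : Graph) where
  open Graph G

  ~-sym⇔ : ∀ {u v} → (u ~ v) ⇔ (v ~ u)
  ~-sym⇔ = mk⇔ ~-sym ~-sym

  IsClique : (Fin n → Set) → Set
  IsClique S = ∀ u v → S u → S v → u ≢ v → u ~ v

  _sees_ : Fin n → (Fin n → Set) → Set
  v sees S = ∃[ u ] (S u × v ~ u)

  ¬sees⇒¬~ : ∀ {S v u} → ¬ v sees S → S u → ¬ v ~ u
  ¬sees⇒¬~ ¬vS Su vu = ¬vS (_ , Su , vu)

  data InducedPath : ∀ {k} → Vec (Fin n) (suc k) → Set where
    [_]  : ∀ v → InducedPath (v ∷ [])
    cons : ∀ {k v w} {us : Vec (Fin n) k} → v ~ w → All (λ u → ¬ v ~ u) us →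
           InducedPath (w ∷ us) → InducedPath (v ∷ w ∷ us)

  head-adjacency : ∀ {k v w} {us : Vec (Fin n) k} → v ~ w → All (λ u → ¬ v ~ u) us →
    ∀ j → (v ~ lookup (w ∷ us) j) ⇔ PathAdj (suc (suc k)) zero (suc j)
  head-adjacency vw _    zero    = ⇔-yes vw (inj₁ refl)
  head-adjacency _  ¬vus (suc j) = ⇔-no (lookup⁺ ¬vus j) [ (λ ()) , (λ ()) ]′

  path-adjacency : ∀ {k} {vs : Vec (Fin n) (suc k)} → InducedPath vs →
    ∀ i j → (lookup vs i ~ lookup vs j) ⇔ PathAdj (suc k) i j
  path-adjacency _                 zero    zero    = ⇔-no ~-irr [ (λ ()) , (λ ()) ]′
  path-adjacency (cons vw ¬vus _)  zero    (suc j) = head-adjacency vw ¬vus j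
  path-adjacency (cons vw ¬vus _)  (suc i) zero    =
    PathAdj-sym ⇔-∘ (head-adjacency vw ¬vus i ⇔-∘ ~-sym⇔)
  path-adjacency (cons _ _ p)      (suc i) (suc j) = ⇔-sym PathAdj-suc ⇔-∘ path-adjacency p i j

  SeesExactlyEnds : ∀ {k} → Fin n → Vec (Fin n) (suc k) → Set
  SeesExactlyEnds w vs = ∀ j → (w ~ lookup vs j) ⇔ IsEnd j

  cycle-adjacency : ∀ {k w} {vs : Vec (Fin n) (suc k)} → InducedPath vs → SeesExactlyEnds w vs →
    ∀ i j → (lookup (w ∷ vs) i ~ lookup (w ∷ vs) j) ⇔ CycleAdj (suc (suc k)) i j
  cycle-adjacency _ _    zero    zero    = ⇔-no ~-irr λ
    { (inj₁ (inj₁ ())) ; (inj₁ (inj₂ ())) ; (inj₂ (inj₁ (_ , ()))) ; (inj₂ (inj₂ (_ , ()))) }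
  cycle-adjacency _ ends zero    (suc j) = IsEnd⇔CycleAdj-zero ⇔-∘ ends j
  cycle-adjacency _ ends (suc i) zero    = CycleAdj-sym ⇔-∘ (IsEnd⇔CycleAdj-zero ⇔-∘ (ends i ⇔-∘ ~-sym⇔))
  cycle-adjacency p _    (suc i) (suc j) = PathAdj⇔CycleAdj-suc ⇔-∘ path-adjacency p i j

  induced-injective : ∀ {k} {R : Fin k → Fin k → Set} {f : Fin k → Fin n} →
    Separates R → (∀ i j → (f i ~ f j) ⇔ R i j) → Injective _≡_ _≡_ f
  induced-injective {f = f} sep adj {i} {j} fi≡fj with sep i j
  ... | inj₁ i≡j            = i≡j
  ... | inj₂ (l , Ril , ¬Rjl) = ⊥-elim (¬Rjl (to (adj j l) (subst (_~ f l) fi≡fj (from (adj i l) Ril))))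

  hasInduced : ∀ {k} {R : Fin k → Fin k → Set} {f : Fin k → Fin n} →
    Separates R → (∀ i j → (f i ~ f j) ⇔ R i j) → HasInduced G k R
  hasInduced {f = f} sep adj = f , induced-injective sep adj , adj

  module _ {a b c d x : Fin n} (ax : a ~ x) (¬bx : ¬ b ~ x) (¬cx : ¬ c ~ x) (¬dx : ¬ d ~ x) where

    C₆-around-P4 : ∀ {z} → InducedP4 G a b c d →
      x ~ z → d ~ z → ¬ a ~ z → ¬ b ~ z → ¬ c ~ z → HasInduced G 6 (CycleAdj 6)
    C₆-around-P4 {z} (ab , bc , cd , ¬ac , ¬ad , ¬bd) xz dz ¬az ¬bz ¬cz =
      hasInduced C₆-separates (cycle-adjacency xabcd ends)
      where
      xabcd : InducedPath (x ∷ a ∷ b ∷ c ∷ d ∷ [])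
      xabcd = cons (~-sym ax) ((¬bx ∘ ~-sym) ∷ (¬cx ∘ ~-sym) ∷ (¬dx ∘ ~-sym) ∷ [])
             (cons ab (¬ac ∷ ¬ad ∷ []) (cons bc (¬bd ∷ []) (cons cd [] [ d ])))
      ends : SeesExactlyEnds z (x ∷ a ∷ b ∷ c ∷ d ∷ [])
      ends zero                         = ⇔-yes (~-sym xz) (inj₁ refl)
      ends (suc zero)                   = ⇔-no (¬az ∘ ~-sym) [ (λ ()) , (λ ()) ]′
      ends (suc (suc zero))             = ⇔-no (¬bz ∘ ~-sym) [ (λ ()) , (λ ()) ]′
      ends (suc (suc (suc zero)))       = ⇔-no (¬cz ∘ ~-sym) [ (λ ()) , (λ ()) ]′
      ends (suc (suc (suc (suc zero)))) = ⇔-yes (~-sym dz) (inj₂ refl)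

    C₇-around-P4 : ∀ {y w} → InducedP4 G a b c d →
      d ~ y → ¬ x ~ y → ¬ a ~ y → ¬ b ~ y → ¬ c ~ y →
      x ~ w → y ~ w → ¬ a ~ w → ¬ b ~ w → ¬ c ~ w → ¬ d ~ w → HasInduced G 7 (CycleAdj 7)
    C₇-around-P4 {y} {w} (ab , bc , cd , ¬ac , ¬ad , ¬bd) dy ¬xy ¬ay ¬by ¬cy xw yw ¬aw ¬bw ¬cw ¬dw =
      hasInduced C₇-separates (cycle-adjacency xabcdy ends)
      where
      xabcdy : InducedPath (x ∷ a ∷ b ∷ c ∷ d ∷ y ∷ [])
      xabcdy = cons (~-sym ax) ((¬bx ∘ ~-sym) ∷ (¬cx ∘ ~-sym) ∷ (¬dx ∘ ~-sym) ∷ ¬xy ∷ [])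
              (cons ab (¬ac ∷ ¬ad ∷ ¬ay ∷ []) (cons bc (¬bd ∷ ¬by ∷ [])
              (cons cd (¬cy ∷ []) (cons dy [] [ y ]))))
      ends : SeesExactlyEnds w (x ∷ a ∷ b ∷ c ∷ d ∷ y ∷ [])
      ends zero                               = ⇔-yes (~-sym xw) (inj₁ refl)
      ends (suc zero)                         = ⇔-no (¬aw ∘ ~-sym) [ (λ ()) , (λ ()) ]′
      ends (suc (suc zero))                   = ⇔-no (¬bw ∘ ~-sym) [ (λ ()) , (λ ()) ]′
      ends (suc (suc (suc zero)))             = ⇔-no (¬cw ∘ ~-sym) [ (λ ()) , (λ ()) ]′
      ends (suc (suc (suc (suc zero))))       = ⇔-no (¬dw ∘ ~-sym) [ (λ ()) , (λ ()) ]′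
      ends (suc (suc (suc (suc (suc zero))))) = ⇔-yes (~-sym yw) (inj₂ refl)

  InducedP4+clique⇒C₆⊎C₇ : ∀ {S a b c d x} → IsClique S → InducedP4 G a b c d →
    a ~ x → ¬ b ~ x → ¬ c ~ x → ¬ d ~ x → x sees S → d sees S →
    ¬ a sees S → ¬ b sees S → ¬ c sees S →
    HasInduced G 6 (CycleAdj 6) ⊎ HasInduced G 7 (CycleAdj 7)
  InducedP4+clique⇒C₆⊎C₇ {S} {a} {b} {c} {d} {x} clique abcd ax ¬bx ¬cx ¬dx
    (x′ , Sx′ , xx′) (y , Sy , dy) ¬aS ¬bS ¬cS = by-cases (~-dec x y) (~-dec d x′)
    where
    avoids-abc : ∀ {z} → S z → ¬ a ~ z × ¬ b ~ z × ¬ c ~ z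
    avoids-abc Sz = ¬sees⇒¬~ ¬aS Sz , ¬sees⇒¬~ ¬bS Sz , ¬sees⇒¬~ ¬cS Sz

    C₆-via : ∀ {z} → S z → x ~ z → d ~ z → HasInduced G 6 (CycleAdj 6)
    C₆-via Sz xz dz with avoids-abc Sz
    ... | ¬az , ¬bz , ¬cz = C₆-around-P4 ax ¬bx ¬cx ¬dx abcd xz dz ¬az ¬bz ¬cz

    by-cases : Dec (x ~ y) → Dec (d ~ x′) → HasInduced G 6 (CycleAdj 6) ⊎ HasInduced G 7 (CycleAdj 7)
    by-cases (yes xy) _         = inj₁ (C₆-via Sy xy dy)
    by-cases (no _)   (yes dx′) = inj₁ (C₆-via Sx′ xx′ dx′)
    by-cases (no ¬xy) (no ¬dx′) with avoids-abc Sy | avoids-abc Sx′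
    ... | ¬ay , ¬by , ¬cy | ¬ax′ , ¬bx′ , ¬cx′ =
      inj₂ (C₇-around-P4 ax ¬bx ¬cx ¬dx abcd dy ¬xy ¬ay ¬by ¬cy xx′ yx′ ¬ax′ ¬bx′ ¬cx′ ¬dx′)
      where
      yx′ : y ~ x′
      yx′ = clique y x′ Sy Sx′ λ y≡x′ → ¬xy (subst (x ~_) (sym y≡x′) xx′)

next-prev : ∀ i → next (prev i) ≡ i
next-prev zero                          = refl
next-prev (suc zero)                    = refl
next-prev (suc (suc zero))              = refl
next-prev (suc (suc (suc zero)))        = refl
next-prev (suc (suc (suc (suc zero))))  = refl

prev-next : ∀ i → prev (next i) ≡ i
prev-next zero                          = refl
prev-next (suc zero)                    = refl
prev-next (suc (suc zero))              = refl
prev-next (suc (suc (suc zero)))        = refl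
prev-next (suc (suc (suc (suc zero))))  = refl

prev³≡next² : ∀ i → prev (prev (prev i)) ≡ next (next i)
prev³≡next² zero                         = refl
prev³≡next² (suc zero)                   = refl
prev³≡next² (suc (suc zero))             = refl
prev³≡next² (suc (suc (suc zero)))       = refl
prev³≡next² (suc (suc (suc (suc zero)))) = refl

prev⁴≡next : ∀ i → prev (prev (prev (prev i))) ≡ next i
prev⁴≡next i = trans (cong prev (prev³≡next² i)) (prev-next (next i))

Near : Fin 5 → Fin 5 → Set
Near i j = j ≡ prev i ⊎ j ≡ i ⊎ j ≡ next i

next²-far : ∀ i → ¬ Near i (next (next i))
next²-far zero                         = λ { (inj₁ ()) ; (inj₂ (inj₁ ())) ; (inj₂ (inj₂ ())) }
next²-far (suc zero)                   = λ { (inj₁ ()) ; (inj₂ (inj₁ ())) ; (inj₂ (inj₂ ())) }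
next²-far (suc (suc zero))             = λ { (inj₁ ()) ; (inj₂ (inj₁ ())) ; (inj₂ (inj₂ ())) }
next²-far (suc (suc (suc zero)))       = λ { (inj₁ ()) ; (inj₂ (inj₁ ())) ; (inj₂ (inj₂ ())) }
next²-far (suc (suc (suc (suc zero)))) = λ { (inj₁ ()) ; (inj₂ (inj₁ ())) ; (inj₂ (inj₂ ())) }

prev²-far : ∀ i → ¬ Near i (prev (prev i))
prev²-far zero                         = λ { (inj₁ ()) ; (inj₂ (inj₁ ())) ; (inj₂ (inj₂ ())) }
prev²-far (suc zero)                   = λ { (inj₁ ()) ; (inj₂ (inj₁ ())) ; (inj₂ (inj₂ ())) }
prev²-far (suc (suc zero))             = λ { (inj₁ ()) ; (inj₂ (inj₁ ())) ; (inj₂ (inj₂ ())) }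
prev²-far (suc (suc (suc zero)))       = λ { (inj₁ ()) ; (inj₂ (inj₁ ())) ; (inj₂ (inj₂ ())) }
prev²-far (suc (suc (suc (suc zero)))) = λ { (inj₁ ()) ; (inj₂ (inj₁ ())) ; (inj₂ (inj₂ ())) }

module _ {G : Graph} {B : Blowup G} (nice : IsNiceBlowup G B) where
  open Graph G
  open IsNiceBlowup nice

  A3′-sees-prev : ∀ {i v} → A3' G B i v → InSupp G B v (prev i)
  A3′-sees-prev {i} (inj₁ (_ , supp)) = from (supp (prev i)) (inj₁ refl)
  A3′-sees-prev {i} (inj₂ v∈Bi)       = nbr-prev i _ v∈Bi

  A3′-sees-next : ∀ {i v} → A3' G B i v → InSupp G B v (next i)
  A3′-sees-next {i} (inj₁ (_ , supp)) = from (supp (next i)) (inj₂ (inj₂ refl))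
  A3′-sees-next {i} (inj₂ v∈Bi)       = nbr-next i _ v∈Bi

  A3′-¬sees-next² : ∀ {i v} → A3' G B i v → ¬ InSupp G B v (next (next i))
  A3′-¬sees-next² {i} (inj₁ (_ , supp)) = next²-far i ∘ to (supp (next (next i)))
  A3′-¬sees-next² {i} (inj₂ v∈Bi) (u , u∈ , vu) = anticomp i _ u v∈Bi u∈ vu

  A3′-¬sees-prev² : ∀ {i v} → A3' G B i v → ¬ InSupp G B v (prev (prev i))
  A3′-¬sees-prev² {i} (inj₁ (_ , supp)) = prev²-far i ∘ to (supp (prev (prev i)))
  A3′-¬sees-prev² {i} (inj₂ v∈Bi) (u , u∈ , vu) =
    anticomp (prev (prev i)) u _ u∈ (subst (λ j → _ ∈ B j) (sym next²prev²≡id) v∈Bi) (~-sym vu)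
    where
    next²prev²≡id : next (next (prev (prev i))) ≡ i
    next²prev²≡id = trans (cong next (next-prev (prev i))) (next-prev i)

lemma4p11 : (G : Graph) → (B : Blowup G)
    → ¬ HasInduced G 7 (PathAdj 7)
    → ¬ HasInduced G 4 (CycleAdj 4)
    → ¬ HasInduced G 6 (CycleAdj 6)
    → ¬ HasInduced G 7 (CycleAdj 7)
    → IsNiceBlowup G B
    → ∀ (i : Fin 5) a b c d
    → A3' G B (prev (prev i)) a → A3' G B (prev i) b → A3' G B (prev i) c → A3' G B i d
    → ¬ InducedP4 G a b c d
lemma4p11 G B _ _ noC₆ noC₇ nice i a b c d a∈ b∈ c∈ d∈ abcd with A3′-sees-prev nice a∈
... | x , x∈ , ax = [ noC₆ , noC₇ ]′ (InducedP4+clique⇒C₆⊎C₇ G (clique (next i)) abcd ax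
      (¬sees⇒¬~ G (A3′-¬sees-prev² nice b∈) x∈)
      (¬sees⇒¬~ G (A3′-¬sees-prev² nice c∈) x∈)
      (¬sees⇒¬~ G (A3′-¬sees-next² nice d∈) (subst (λ j → x ∈ B j) (prev³≡next² i) x∈))
      (subst (InSupp G B x) (prev⁴≡next i) (nbr-prev _ x x∈))
      (A3′-sees-next nice d∈)
      (subst (¬_ ∘ InSupp G B a) (prev⁴≡next i) (A3′-¬sees-prev² nice a∈))
      (subst (¬_ ∘ InSupp G B b) (cong next (next-prev i)) (A3′-¬sees-next² nice b∈))
      (subst (¬_ ∘ InSupp G B c) (cong next (next-prev i)) (A3′-¬sees-next² nice c∈)))
  where open IsNiceBlowup nice
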